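{- Let $G$ be a toroidal triangulation, $D_0$ the orientation of a crossing Schnyder wood of $G$, and $O(G)$ the set of orientations of $G$ homologous to $D_0$. For an edge $e$ of $G$ the following are equivalent: (1) $e$ is non-rigid w.r.t. $O(G)$; (2) $e$ is contained in a $0$-homologous oriented subgraph of $D_0$; (3) for every $D\in O(G)$, $e$ is contained in a $0$-homologous oriented subgraph of $D$.
   Context: Graphs on surfaces may have loops and multiple edges but no contractible cycle of length 1 or 2; a toroidal triangulation is a map on the torus with all faces triangles. Schnyder wood: orientation and coloring with colors $0,1,2$ of all edges such that every vertex $v$ has one outgoing edge $e_i(v)$ of each color, in counterclockwise order $e_0,e_1,e_2$, and each edge entering $v$ in color $i$ lies in the counterclockwise sector from $e_{i+1}(v)$ to $e_{i-1}(v)$; crossing: for each pair of distinct colors some monochromatic cycles of these colors intersect (crossing Schnyder woods exist, known). Homology: w.r.t. a fixed reference orientation, the characteristic flow of an oriented subgraph in $\mathbb Z^E$ is $+1$/$-1$ on edges oriented as/against the reference; it is $0$-homologous if it is an integer combination of characteristic flows of counterclockwise facial walks. For orientations $D,D'$, $D\setminus D'$ is the oriented subgraph of $D$ formed by edges oriented differently in $D'$; $D,D'$ are homologous if $D\setminus D'$ is $0$-homologous. An edge is rigid w.r.t. $O(G)$ if it has the same orientation in all elements of $O(G)$, non-rigid otherwise. -}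

module Defs where

open import Data.Nat using (ℕ; zero; suc; _≤_; _%_)
open import Data.Nat.DivMod using (m%n<n)
open import Data.Integer using (ℤ; +_; -_; _+_; _*_)
open import Data.Fin using (Fin; zero; suc; toℕ; fromℕ<; _≟_)
open import Data.Bool using (Bool; true; false; not; if_then_else_; _xor_)
open import Data.Product using (Σ; ∃; _×_; _,_; proj₁; proj₂)
open import Relation.Nullary using (¬_; does)
open import Relation.Binary.PropositionalEquality using (_≡_; _≢_)
open import Relation.Binary.Construct.Closure.ReflexiveTransitive using (Star)

-- Reference orientation: edge e is oriented from the origin of dart
-- (e , true) to the origin of dart (e , false).

Dart : ℕ → Set
Dart m = Fin m × Bool

α : ∀ {m} → Dart m → Dart m
α (e , b) = (e , not b)

edge : ∀ {m} → Dart m → Fin m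
edge = proj₁

iter : ∀ {A : Set} → (A → A) → ℕ → A → A
iter f zero x = x
iter f (suc k) x = f (iter f k x)

data Step {m : ℕ} (σ : Dart m → Dart m) : Dart m → Dart m → Set where
  byσ : ∀ x → Step σ x (σ x)
  byα : ∀ x → Step σ x (α x)

Flow : ℕ → Set
Flow m = Fin m → ℤ

_+f_ : ∀ {m} → Flow m → Flow m → Flow m
(φ +f ψ) e = φ e + ψ e

sgn : Bool → ℤ
sgn true = + 1
sgn false = - (+ 1)

dartFlow : ∀ {m} → Dart m → Flow m
dartFlow (e , b) e' = if does (e' ≟ e) then sgn b else + 0

sumFin : ∀ {n} → (Fin n → ℤ) → ℤ
sumFin {zero} f = + 0
sumFin {suc n} f = f zero + sumFin (λ i → f (suc i))

-- Maps.  σ is the counterclockwise rotation of darts around their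
-- origin vertex.  Vertices are labelled by Fin nV (the σ-orbits),
-- faces by Fin nF: face x is the face on the LEFT of dart x, i.e. the
-- orbits of x ↦ α (σ x) (the inverse of the counterclockwise face
-- traversal x ↦ σ⁻¹ (α x)).

faceStep : ∀ {m} → (Dart m → Dart m) → Dart m → Dart m
faceStep σ x = α (σ x)

record Map : Set where
  field
    m nV nF : ℕ
    σ σ⁻ : Dart m → Dart m
    σσ⁻ : ∀ x → σ (σ⁻ x) ≡ x
    σ⁻σ : ∀ x → σ⁻ (σ x) ≡ x
    vert : Dart m → Fin nV
    vert-σ : ∀ x → vert (σ x) ≡ vert x
    vert-orbit : ∀ x y → vert x ≡ vert y → ∃ λ k → iter σ k x ≡ y
    vert-surj : ∀ v → ∃ λ x → vert x ≡ v
    face : Dart m → Fin nF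
    face-step : ∀ x → face (faceStep σ x) ≡ face x
    face-orbit : ∀ x y → face x ≡ face y → ∃ λ k → iter (faceStep σ) k x ≡ y
    face-surj : ∀ f → ∃ λ x → face x ≡ f
    connected : ∀ x y → Star (Step σ) x y

module _ (G : Map) where
  open Map G

  -- characteristic flow of the counterclockwise facial walk of face f
  faceFlow : Fin nF → Flow m
  faceFlow f e = (if does (face (e , true) ≟ f) then sgn true else + 0)
               + (if does (face (e , false) ≟ f) then sgn false else + 0)

  ZeroHomologous : Flow m → Set
  ZeroHomologous φ = Σ (Fin nF → ℤ) λ c → ∀ e → φ e ≡ sumFin (λ f → c f * faceFlow f e)

  -- no contractible (= 0-homologous, on the torus) cycle of length 1 or 2
  NoContractibleLoop : Set
  NoContractibleLoop = ∀ x → vert x ≡ vert (α x) → ¬ ZeroHomologous (dartFlow x)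

  NoContractible2Cycle : Set
  NoContractible2Cycle = ∀ x y → edge x ≢ edge y → vert x ≢ vert y →
    vert (α x) ≡ vert y → vert (α y) ≡ vert x →
    ¬ ZeroHomologous (dartFlow x +f dartFlow y)

  -- Euler characteristic 0 (torus): nV - m + nF = 0
  EulerTorus : Set
  EulerTorus = nV Data.Nat.+ nF ≡ m

  AllTriangles : Set
  AllTriangles = ∀ x → (iter (faceStep σ) 3 x ≡ x) × (faceStep σ x ≢ x)

record ToroidalTriangulation : Set where
  field
    map : Map
    torus : EulerTorus map
    triangles : AllTriangles map
    noLoop : NoContractibleLoop map
    no2cycle : NoContractible2Cycle map
  open Map map public

module _ (G : ToroidalTriangulation) where
  open ToroidalTriangulation G

  Edge : Set
  Edge = Fin m

  -- D e = true : e oriented as the reference orientation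
  Orientation : Set
  Orientation = Fin m → Bool

  -- an oriented subgraph of D is given by its edge set S (oriented as in D)
  Subgraph : Set
  Subgraph = Fin m → Bool

  charFlow : Orientation → Subgraph → Flow m
  charFlow D S e = if S e then sgn (D e) else + 0

  diff : Orientation → Orientation → Subgraph
  diff D D' e = D e xor D' e

  Homologous : Orientation → Orientation → Set
  Homologous D D' = ZeroHomologous map (charFlow D (diff D D'))

  InZeroHomSubgraph : Orientation → Edge → Set
  InZeroHomSubgraph D e = Σ Subgraph λ S → (S e ≡ true) × ZeroHomologous map (charFlow D S)

  NonRigid : Orientation → Edge → Set
  NonRigid D0 e = Σ Orientation λ D → Σ Orientation λ D' →
    Homologous D D0 × Homologous D' D0 × (D e ≢ D' e)

  Coloring : Set
  Coloring = Fin m → Fin 3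

  suc3 pred3 : Fin 3 → Fin 3
  suc3 zero = suc zero
  suc3 (suc zero) = suc (suc zero)
  suc3 (suc (suc zero)) = zero
  pred3 zero = suc (suc zero)
  pred3 (suc zero) = zero
  pred3 (suc (suc zero)) = suc zero

  Out : Orientation → Dart m → Set
  Out D x = D (edge x) ≡ proj₂ x

  In : Orientation → Dart m → Set
  In D x = D (edge x) ≡ not (proj₂ x)

  IsOutColor : Orientation → Coloring → Fin nV → Fin 3 → Dart m → Set
  IsOutColor D col v i x = (vert x ≡ v) × Out D x × (col (edge x) ≡ i)

  Before : Dart m → Dart m → Dart m → Set
  Before x y z = ∃ λ k → (1 ≤ k) × (iter σ k x ≡ y) ×
    (∀ j → 1 ≤ j → j ≤ k → iter σ j x ≢ z)

  SchnyderWood : Orientation → Coloring → Set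
  SchnyderWood D col =
    (∀ v i → ∃ λ x → IsOutColor D col v i x) ×
    (∀ v i x y → IsOutColor D col v i x → IsOutColor D col v i y → x ≡ y) ×
    (∀ v x y z → IsOutColor D col v zero x → IsOutColor D col v (suc zero) y →
       IsOutColor D col v (suc (suc zero)) z → Before x y z) ×
    (∀ v i y x z → vert y ≡ v → In D y → col (edge y) ≡ i →
       IsOutColor D col v (suc3 i) x → IsOutColor D col v (pred3 i) z → Before x y z)

  nextF : ∀ {n} → Fin (suc n) → Fin (suc n)
  nextF {n} t = fromℕ< (m%n<n (suc (toℕ t)) (suc n))

  record MonoCycle (D : Orientation) (col : Coloring) (i : Fin 3) : Set where
    field
      len : ℕ
      ds : Fin (suc len) → Dart m
      closed : ∀ t → vert (α (ds t)) ≡ vert (ds (nextF t))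
      distinct : ∀ s t → vert (ds s) ≡ vert (ds t) → s ≡ t
      mono : ∀ t → Out D (ds t) × (col (edge (ds t)) ≡ i)

  Crossing : Orientation → Coloring → Set
  Crossing D col = ∀ i j → i ≢ j →
    Σ (MonoCycle D col i) λ C → Σ (MonoCycle D col j) λ C' →
      ∃ λ s → ∃ λ t → vert (MonoCycle.ds C s) ≡ vert (MonoCycle.ds C' t)

  CrossingSchnyderOrientation : Orientation → Set
  CrossingSchnyderOrientation D = Σ Coloring λ col → SchnyderWood D col × Crossing D col

-- Every orientation D homologous to D₀ differs from D₀ exactly on the
-- 0-homologous oriented subgraph D₀ ∖ D; conversely, reversing a 0-homologous
-- oriented subgraph S of D₀ gives an orientation homologous to D₀ that differs
-- from D₀ exactly on S.  Hence the non-rigid edges are those lying in some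
-- 0-homologous subgraph of D₀.  As 0-homologous flows form a subgroup of ℤ^E,
-- an edge of such an S outside D ∖ D₀ lies in the symmetric difference of S
-- and D ∖ D₀, a 0-homologous oriented subgraph of D.
module Submission where

open import Defs
open import Data.Bool using (true; false; not; _xor_; _≟_)
open import Data.Bool.Properties using (xor-comm; not-¬)
open import Data.Fin using (Fin; zero; suc)
open import Data.Integer using (ℤ; +_; -_; _+_; _*_; -1ℤ)
open import Data.Integer.Properties using (+-*-semiring; *-assoc; *-distribʳ-+; -1*i≡-i)
open import Data.Nat using (zero; suc)
open import Data.Empty using (⊥-elim)
open import Data.Product using (_×_; _,_)
open import Relation.Nullary using (yes; no)
open import Function.Bundles using (_⇔_; mk⇔)
open import Relation.Binary.PropositionalEquality
  using (_≡_; _≢_; _≗_; refl; sym; trans; cong; cong₂; module ≡-Reasoning)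
import Algebra.Properties.Semiring.Sum as SemiringSum

open SemiringSum +-*-semiring using (sum; sum-cong-≗; sum-replicate-zero; ∑-distrib-+; *-distribˡ-sum)

sumFin≡sum : ∀ {n} (f : Fin n → ℤ) → sumFin f ≡ sum f
sumFin≡sum {zero}  f = refl
sumFin≡sum {suc n} f = cong (λ s → f zero + s) (sumFin≡sum (λ i → f (suc i)))

module _ (M : Map) where
  open Map M

  ∂ : (Fin nF → ℤ) → Flow m
  ∂ c e = sumFin (λ f → c f * faceFlow M f e)

  ∂-sum : ∀ (c : Fin nF → ℤ) (e : Fin m) → ∂ c e ≡ sum (λ f → c f * faceFlow M f e)
  ∂-sum c e = sumFin≡sum (λ f → c f * faceFlow M f e)

  zeroHomologous-resp : ∀ {φ ψ : Flow m} → φ ≗ ψ → ZeroHomologous M φ → ZeroHomologous M ψ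
  zeroHomologous-resp φ≗ψ (c , φ≗∂c) = c , λ e → trans (sym (φ≗ψ e)) (φ≗∂c e)

  zeroHomologous-0 : ZeroHomologous M (λ _ → + 0)
  zeroHomologous-0 = (λ _ → + 0) , λ e → begin
    + 0                                   ≡⟨ sum-replicate-zero nF ⟨
    sum {nF} (λ _ → + 0)                  ≡⟨ ∂-sum (λ _ → + 0) e ⟨
    ∂ (λ _ → + 0) e                       ∎
    where open ≡-Reasoning

  zeroHomologous-+ : ∀ {φ ψ : Flow m} → ZeroHomologous M φ → ZeroHomologous M ψ →
                     ZeroHomologous M (φ +f ψ)
  zeroHomologous-+ {φ} {ψ} (c , φ≗∂c) (d , ψ≗∂d) = (λ f → c f + d f) , λ e → begin
    φ e + ψ e
      ≡⟨ cong₂ _+_ (trans (φ≗∂c e) (∂-sum c e)) (trans (ψ≗∂d e) (∂-sum d e)) ⟩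
    sum (λ f → c f * faceFlow M f e) + sum (λ f → d f * faceFlow M f e)
      ≡⟨ ∑-distrib-+ (λ f → c f * faceFlow M f e) (λ f → d f * faceFlow M f e) ⟨
    sum (λ f → c f * faceFlow M f e + d f * faceFlow M f e)
      ≡⟨ sum-cong-≗ (λ f → *-distribʳ-+ (faceFlow M f e) (c f) (d f)) ⟨
    sum (λ f → (c f + d f) * faceFlow M f e)
      ≡⟨ ∂-sum (λ f → c f + d f) e ⟨
    ∂ (λ f → c f + d f) e ∎
    where open ≡-Reasoning

  zeroHomologous-* : ∀ k {φ : Flow m} → ZeroHomologous M φ → ZeroHomologous M (λ e → k * φ e)
  zeroHomologous-* k {φ} (c , φ≗∂c) = (λ f → k * c f) , λ e → begin
    k * φ e
      ≡⟨ cong (k *_) (trans (φ≗∂c e) (∂-sum c e)) ⟩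
    k * sum (λ f → c f * faceFlow M f e)
      ≡⟨ *-distribˡ-sum k (λ f → c f * faceFlow M f e) ⟩
    sum (λ f → k * (c f * faceFlow M f e))
      ≡⟨ sum-cong-≗ (λ f → *-assoc k (c f) (faceFlow M f e)) ⟨
    sum (λ f → k * c f * faceFlow M f e)
      ≡⟨ ∂-sum (λ f → k * c f) e ⟨
    ∂ (λ f → k * c f) e ∎
    where open ≡-Reasoning

  zeroHomologous-neg : ∀ {φ : Flow m} → ZeroHomologous M φ → ZeroHomologous M (λ e → - φ e)
  zeroHomologous-neg h = zeroHomologous-resp (λ e → -1*i≡-i _) (zeroHomologous-* -1ℤ h)

module _ (G : ToroidalTriangulation) where
  open ToroidalTriangulation G

  reverse : Orientation G → Subgraph G → Orientation G
  reverse D S e = D e xor S e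

  symmetricDifference : Subgraph G → Subgraph G → Subgraph G
  symmetricDifference S T e = S e xor T e

  charFlow-diff-self : ∀ D → charFlow G D (diff G D D) ≗ (λ _ → + 0)
  charFlow-diff-self D e with D e
  ... | true  = refl
  ... | false = refl

  charFlow-diff-comm : ∀ D D′ →
    charFlow G D′ (diff G D′ D) ≗ (λ e → - charFlow G D (diff G D D′) e)
  charFlow-diff-comm D D′ e with D e | D′ e
  ... | true  | true  = refl
  ... | true  | false = refl
  ... | false | true  = refl
  ... | false | false = refl

  charFlow-diff-reverse : ∀ D S → charFlow G D (diff G D (reverse D S)) ≗ charFlow G D S
  charFlow-diff-reverse D S e with D e | S e
  ... | true  | true  = refl
  ... | true  | false = refl
  ... | false | true  = refl
  ... | false | false = refl

  charFlow-symmetricDifference : ∀ D D₀ S →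
    charFlow G D (symmetricDifference S (diff G D D₀)) ≗
    (charFlow G D₀ S +f charFlow G D (diff G D D₀))
  charFlow-symmetricDifference D D₀ S e with S e | D e | D₀ e
  ... | true  | true  | true  = refl
  ... | true  | true  | false = refl
  ... | true  | false | true  = refl
  ... | true  | false | false = refl
  ... | false | true  | true  = refl
  ... | false | true  | false = refl
  ... | false | false | true  = refl
  ... | false | false | false = refl

  homologous-refl : ∀ D → Homologous G D D
  homologous-refl D =
    zeroHomologous-resp map (λ e → sym (charFlow-diff-self D e)) (zeroHomologous-0 map)

  homologous-sym : ∀ D D′ → Homologous G D D′ → Homologous G D′ D
  homologous-sym D D′ h =
    zeroHomologous-resp map (λ e → sym (charFlow-diff-comm D D′ e)) (zeroHomologous-neg map h)

  reverse-homologous : ∀ D S → ZeroHomologous map (charFlow G D S) → Homologous G D (reverse D S)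
  reverse-homologous D S = zeroHomologous-resp map (λ e → sym (charFlow-diff-reverse D S e))

  reverse-flips : ∀ D {S e} → S e ≡ true → reverse D S e ≡ not (D e)
  reverse-flips D {S} {e} Se = trans (cong (D e xor_) Se) (xor-comm (D e) true)

  differing-inZeroHomSubgraph : ∀ D D₀ {e} → Homologous G D D₀ → D e ≢ D₀ e →
                                InZeroHomSubgraph G D₀ e
  differing-inZeroHomSubgraph D D₀ {e} h De≢D₀e =
    diff G D₀ D , differs (D₀ e) (D e) De≢D₀e , homologous-sym D D₀ h
    where
    differs : ∀ a b → b ≢ a → a xor b ≡ true
    differs true  true  b≢a = ⊥-elim (b≢a refl)
    differs true  false _   = refl
    differs false true  _   = refl
    differs false false b≢a = ⊥-elim (b≢a refl)

  nonRigid⇒inZeroHomSubgraph : ∀ {D₀ e} → NonRigid G D₀ e → InZeroHomSubgraph G D₀ e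
  nonRigid⇒inZeroHomSubgraph {D₀} {e} (D , D′ , h , h′ , De≢D′e) with D e ≟ D₀ e
  ... | no  De≢D₀e = differing-inZeroHomSubgraph D D₀ h De≢D₀e
  ... | yes De≡D₀e =
    differing-inZeroHomSubgraph D′ D₀ h′ (λ D′e≡D₀e → De≢D′e (trans De≡D₀e (sym D′e≡D₀e)))

  inZeroHomSubgraph⇒nonRigid : ∀ {D₀ e} → InZeroHomSubgraph G D₀ e → NonRigid G D₀ e
  inZeroHomSubgraph⇒nonRigid {D₀} (S , Se , z) =
    D₀ , reverse D₀ S ,
    homologous-refl D₀ , homologous-sym D₀ (reverse D₀ S) (reverse-homologous D₀ S z) ,
    λ D₀e≡ → not-¬ refl (trans D₀e≡ (reverse-flips D₀ {S} Se))

  inZeroHomSubgraph-transport : ∀ D D₀ {e} → InZeroHomSubgraph G D₀ e → Homologous G D D₀ →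
                                InZeroHomSubgraph G D e
  inZeroHomSubgraph-transport D D₀ {e} (S , Se , z) h with diff G D D₀ e in e∈D∖D₀
  ... | true  = diff G D D₀ , e∈D∖D₀ , h
  ... | false = symmetricDifference S (diff G D D₀) , cong₂ _xor_ Se e∈D∖D₀ ,
                zeroHomologous-resp map (λ x → sym (charFlow-symmetricDifference D D₀ S x))
                  (zeroHomologous-+ map z h)

lemma11 : (G : ToroidalTriangulation) (D₀ : Orientation G) →
    CrossingSchnyderOrientation G D₀ → (e : Edge G) →
    (NonRigid G D₀ e ⇔ InZeroHomSubgraph G D₀ e) ×
    (InZeroHomSubgraph G D₀ e ⇔ (∀ D → Homologous G D D₀ → InZeroHomSubgraph G D e))
lemma11 G D₀ _ e =
  mk⇔ (nonRigid⇒inZeroHomSubgraph G) (inZeroHomSubgraph⇒nonRigid G) ,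
  mk⇔ (λ S D h → inZeroHomSubgraph-transport G D D₀ S h) (λ all → all D₀ (homologous-refl G D₀))
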